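{- Let $G$ be a finite abelian group of order $n$ and let $H$ be a $d$-dimensional Latin hypercube of order $n$ indexed by $G$. If $T=\{\alpha_1,\dots,\alpha_n\}$ is a transversal of $H$, then $\sum_{i=1}^n\Delta(\alpha_i)=(1-d)G_+$.
   Context: A $d$-dimensional hypercube of order $n$ indexed by $G$ is a map $H:G^d\to G$ with entries $(x_1,\dots,x_d;H(x_1,\dots,x_d))$. A line is obtained by fixing all but one coordinate and a hyperplane by fixing one coordinate; $H$ is Latin if every line contains every element of $G$ as a symbol. A transversal is a set of $n$ entries no two of which agree in any coordinate and whose symbols are pairwise distinct. For an entry $e=(x_1,\dots,x_d;\sigma)$, $\Delta(e)=\sigma-x_1-\cdots-x_d\in G$. $G_+$ denotes the sum of all elements of $G$. -}

module Defs where

open import Data.Nat using (ℕ; zero; suc)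
open import Data.Fin using (Fin; zero; suc; _≟_)
open import Data.Product using (∃; _×_)
open import Relation.Nullary using (¬_; yes; no)
open import Relation.Binary.PropositionalEquality using (_≡_)
open import Algebra.Structures using (IsAbelianGroup)

-- A finite abelian group of order n is represented (up to isomorphism) by
-- an abelian group structure on the carrier Fin n, with propositional equality.
record FinAbGroup (n : ℕ) : Set where
  field
    _∙_ : Fin n → Fin n → Fin n
    ε   : Fin n
    _⁻¹ : Fin n → Fin n
    isAbelianGroup : IsAbelianGroup _≡_ _∙_ ε _⁻¹

module _ {n : ℕ} (G : FinAbGroup n) where
  open FinAbGroup G

  sumG : (m : ℕ) → (Fin m → Fin n) → Fin n
  sumG zero    f = ε
  sumG (suc m) f = f zero ∙ sumG m (λ i → f (suc i))

  mulG : ℕ → Fin n → Fin n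
  mulG zero    a = ε
  mulG (suc k) a = a ∙ mulG k a

  Gplus : Fin n
  Gplus = sumG n (λ g → g)

  Point : ℕ → Set
  Point d = Fin d → Fin n

  Hypercube : ℕ → Set
  Hypercube d = Point d → Fin n

  update : {d : ℕ} → Point d → Fin d → Fin n → Point d
  update x k g j with j ≟ k
  ... | yes _ = g
  ... | no  _ = x j

  IsLatin : {d : ℕ} → Hypercube d → Set
  IsLatin {d} H = (k : Fin d) (x : Point d) (s : Fin n) → ∃ λ g → H (update x k g) ≡ s

  -- a transversal: n entries (given by their positions; the symbol of the
  -- entry at position x is H x), pairwise distinct in every coordinate and
  -- in the symbol
  IsTransversal : {d : ℕ} → Hypercube d → (Fin n → Point d) → Set
  IsTransversal {d} H T =
    (i j : Fin n) → ¬ i ≡ j → ((k : Fin d) → ¬ T i k ≡ T j k) × ¬ H (T i) ≡ H (T j)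

  Δ : {d : ℕ} → Point d → Fin n → Fin n
  Δ {d} x σ = σ ∙ (sumG d x ⁻¹)

-- Sum the identity Δ(x; σ) = σ − Σₖ xₖ over the transversal.  Its symbols,
-- and for every k its k-th coordinates, are n pairwise distinct elements of
-- G, i.e. each of these d + 1 families runs through G exactly once and sums
-- to G₊.  Hence Σᵢ Δ(αᵢ) = G₊ − d·G₊.
module Submission where

open import Defs
open import Algebra.Bundles using (CommutativeMonoid; AbelianGroup)
import Algebra.Properties.AbelianGroup as AbelianGroupProperties
import Algebra.Properties.CommutativeMonoid.Sum as CommutativeMonoidSum
open import Data.Empty using (⊥-elim)
open import Data.Fin using (Fin; zero; suc; punchOut; _≟_)
open import Data.Fin.Permutation using (Permutation′; permutation)
open import Data.Fin.Properties using (any?; punchOut-injective; <⇒notInjective)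
open import Data.Nat using (ℕ; zero; suc)
open import Data.Nat.Properties using (n<1+n)
open import Data.Product using (_,_; proj₁; proj₂)
open import Function using (_∘_; id)
open import Function.Definitions using (Injective; StrictlySurjective)
open import Level using (0ℓ)
open import Relation.Binary.PropositionalEquality using (_≡_; _≢_; refl; cong; cong₂; module ≡-Reasoning)
import Relation.Binary.PropositionalEquality as ≡
open import Relation.Nullary using (yes; no)
open import Relation.Nullary.Decidable using (decidable-stable)

distinct⇒injective : ∀ {m a} {A : Set a} {f : Fin m → A} →
                     (∀ i j → i ≢ j → f i ≢ f j) → Injective _≡_ _≡_ f
distinct⇒injective distinct {i} {j} fi≡fj =
  decidable-stable (i ≟ j) (λ i≢j → distinct i j i≢j fi≡fj)

injective⇒strictlySurjective : ∀ {n} {f : Fin n → Fin n} →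
                               Injective _≡_ _≡_ f → StrictlySurjective _≡_ f
injective⇒strictlySurjective {zero} _ ()
injective⇒strictlySurjective {suc m} {f} f-injective y with any? (λ x → f x ≟ y)
... | yes y∈image = y∈image
-- Were y not hit, punching it out of the image would inject Fin (suc m) into Fin m.
... | no  y∉image = ⊥-elim (<⇒notInjective (n<1+n m) punchOut∘f-injective)
  where
  y≢f : ∀ x → y ≢ f x
  y≢f x y≡fx = y∉image (x , ≡.sym y≡fx)

  punchOut∘f : Fin (suc m) → Fin m
  punchOut∘f x = punchOut (y≢f x)

  punchOut∘f-injective : Injective _≡_ _≡_ punchOut∘f
  punchOut∘f-injective {a} {b} = f-injective ∘ punchOut-injective (y≢f a) (y≢f b)

injective⇒permutation : ∀ {n} {f : Fin n → Fin n} → Injective _≡_ _≡_ f → Permutation′ n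
injective⇒permutation {f = f} f-injective =
  permutation f (proj₁ ∘ preimage) (proj₂ ∘ preimage) (f-injective ∘ proj₂ ∘ preimage ∘ f)
  where
  preimage : StrictlySurjective _≡_ f
  preimage = injective⇒strictlySurjective f-injective

module _ {c ℓ} (M : CommutativeMonoid c ℓ) where
  open CommutativeMonoid M using (Carrier; _≈_)
  open CommutativeMonoidSum M using (sum; sum-permute)

  sum-∘-injective : ∀ {n} (g : Fin n → Carrier) {f : Fin n → Fin n} →
                    Injective _≡_ _≡_ f → sum g ≈ sum (g ∘ f)
  sum-∘-injective g f-injective = sum-permute g (injective⇒permutation f-injective)

module _ {c ℓ} (A : AbelianGroup c ℓ) where
  open AbelianGroup A
  open CommutativeMonoidSum commutativeMonoid using (sum; ∑-distrib-+; ∑-comm)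
  open AbelianGroupProperties A using (ε⁻¹≈ε; ⁻¹-∙-comm)
  open import Relation.Binary.Reasoning.Setoid setoid

  sum-⁻¹ : ∀ {m} (f : Fin m → Carrier) → sum (λ i → f i ⁻¹) ≈ sum f ⁻¹
  sum-⁻¹ {zero}  f = sym ε⁻¹≈ε
  sum-⁻¹ {suc m} f = trans (∙-congˡ (sum-⁻¹ (f ∘ suc))) (⁻¹-∙-comm (f zero) (sum (f ∘ suc)))

  sum-minus-row-sums : ∀ {m d} (σ : Fin m → Carrier) (x : Fin m → Fin d → Carrier) →
                       sum (λ i → σ i ∙ sum (x i) ⁻¹) ≈ sum σ ∙ sum (λ k → sum (λ i → x i k)) ⁻¹
  sum-minus-row-sums σ x = begin
    sum (λ i → σ i ∙ sum (x i) ⁻¹)          ≈⟨ ∑-distrib-+ σ _ ⟩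
    sum σ ∙ sum (λ i → sum (x i) ⁻¹)        ≈⟨ ∙-congˡ (sum-⁻¹ (sum ∘ x)) ⟩
    sum σ ∙ sum (λ i → sum (x i)) ⁻¹        ≈⟨ ∙-congˡ (⁻¹-cong (∑-comm x)) ⟩
    sum σ ∙ sum (λ k → sum (λ i → x i k)) ⁻¹ ∎

module FinAbGroupSums {n} (G : FinAbGroup n) where
  open FinAbGroup G using (isAbelianGroup)

  abelianGroup : AbelianGroup 0ℓ 0ℓ
  abelianGroup = record { _≈_ = _≡_ ; isAbelianGroup = isAbelianGroup }

  open AbelianGroup abelianGroup public using (_∙_; _⁻¹; commutativeMonoid)
  open CommutativeMonoidSum commutativeMonoid using (sum; sum-cong-≗)

  sumG≡sum : ∀ m (f : Fin m → Fin n) → sumG G m f ≡ sum f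
  sumG≡sum zero    f = refl
  sumG≡sum (suc m) f = cong (f zero ∙_) (sumG≡sum m (f ∘ suc))

  mulG≡sum-const : ∀ d a → mulG G d a ≡ sum {d} (λ _ → a)
  mulG≡sum-const zero    a = refl
  mulG≡sum-const (suc d) a = cong (a ∙_) (mulG≡sum-const d a)

  sum-injective≡Gplus : {f : Fin n → Fin n} → Injective _≡_ _≡_ f → sum f ≡ Gplus G
  sum-injective≡Gplus f-injective =
    ≡.sym (≡.trans (sumG≡sum n id) (sum-∘-injective commutativeMonoid id f-injective))

  sum-Δ : ∀ {m d} (x : Fin m → Point G d) (σ : Fin m → Fin n) →
          sumG G m (λ i → Δ G (x i) (σ i)) ≡ sum σ ∙ sum (λ k → sum (λ i → x i k)) ⁻¹
  sum-Δ {m} {d} x σ = begin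
    sumG G m (λ i → σ i ∙ sumG G d (x i) ⁻¹) ≡⟨ sumG≡sum m _ ⟩
    sum (λ i → σ i ∙ sumG G d (x i) ⁻¹)      ≡⟨ sum-cong-≗ (λ i → cong (λ s → σ i ∙ s ⁻¹) (sumG≡sum d (x i))) ⟩
    sum (λ i → σ i ∙ sum (x i) ⁻¹)           ≡⟨ sum-minus-row-sums abelianGroup σ x ⟩
    sum σ ∙ sum (λ k → sum (λ i → x i k)) ⁻¹ ∎
    where open ≡-Reasoning

  module _ {d} (H : Hypercube G d) (T : Fin n → Point G d) (transversal : IsTransversal G H T) where

    transversal-symbols-injective : Injective _≡_ _≡_ (H ∘ T)
    transversal-symbols-injective = distinct⇒injective (λ i j i≢j → proj₂ (transversal i j i≢j))

    transversal-coordinate-injective : ∀ k → Injective _≡_ _≡_ (λ i → T i k)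
    transversal-coordinate-injective k = distinct⇒injective (λ i j i≢j → proj₁ (transversal i j i≢j) k)

lemma1p1 : (n d : ℕ) (G : FinAbGroup n) (H : Hypercube G d) → IsLatin G H →
           (T : Fin n → Point G d) → IsTransversal G H T →
           sumG G n (λ i → Δ G (T i) (H (T i)))
             ≡ FinAbGroup._∙_ G (Gplus G) (FinAbGroup._⁻¹ G (mulG G d (Gplus G)))
lemma1p1 n d G H _ T transversal = begin
  sumG G n (λ i → Δ G (T i) (H (T i)))           ≡⟨ sum-Δ T (H ∘ T) ⟩
  sum (H ∘ T) ∙ sum (λ k → sum (λ i → T i k)) ⁻¹ ≡⟨ cong₂ (λ s t → s ∙ t ⁻¹) symbols-sum coordinates-sum ⟩
  Gplus G ∙ sum {d} (λ _ → Gplus G) ⁻¹           ≡⟨ cong (λ s → Gplus G ∙ s ⁻¹) (mulG≡sum-const d (Gplus G)) ⟨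
  Gplus G ∙ mulG G d (Gplus G) ⁻¹                ∎
  where
  open FinAbGroupSums G
  open CommutativeMonoidSum commutativeMonoid using (sum; sum-cong-≗)
  open ≡-Reasoning

  symbols-sum : sum (H ∘ T) ≡ Gplus G
  symbols-sum = sum-injective≡Gplus (transversal-symbols-injective H T transversal)

  coordinates-sum : sum (λ k → sum (λ i → T i k)) ≡ sum {d} (λ _ → Gplus G)
  coordinates-sum =
    sum-cong-≗ (λ k → sum-injective≡Gplus (transversal-coordinate-injective H T transversal k))
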